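{- Let $d \ge 2$ and $n = 2d+2$. Let $D_d = v \ast \Sigma^{d-1}_{2d+1}$ be the cone, with apex a new vertex $v$, over the $(d-1)$-skeleton of the $2d$-simplex on $2d+1$ vertices; that is, $D_d$ is the pure $d$-dimensional simplicial complex on $n = 2d+2$ vertices whose facets are the sets $\{v\} \cup A$, where $A$ ranges over the $d$-element subsets of a fixed set $V$ of $2d+1$ vertices (with $v \notin V$). Then every vertex of $D_d$ is contained in more than $\frac{n}{2}$ facets of $D_d$, and yet $D_d$ admits neither a weakly-Hamiltonian path nor a weakly-Hamiltonian cycle (in particular it admits no tight- or loose-Hamiltonian path or cycle either).
   Context: Let $\Delta$ be a pure $d$-dimensional simplicial complex on $n$ vertices. For a labeling of the vertices of $\Delta$ by $1,\dots,n$ and an integer $i$, let $H_i$ denote the $d$-face with vertices $i, i+1, \dots, i+d$, where the sums are taken modulo $n$. A weakly-Hamiltonian path in $\Delta$ is a labeling of the vertices by $1,\dots,n$ together with indices $1 = i_1 < i_2 < \dots < i_k = n-d$ such that every $H_{i_j}$ is a facet of $\Delta$ and $i_{j+1} - i_j \le d$ for all $j$ (so consecutive faces share a vertex and together they cover all vertices). A weakly-Hamiltonian cycle in $\Delta$ is a labeling of the vertices by $1,\dots,n$ together with indices $1 \le i_1 < \dots < i_k \le n$ such that every $H_{i_j}$ is a facet of $\Delta$, the union of the $H_{i_j}$ is the whole vertex set, $H_{i_j} \cap H_{i_{j+1}} \neq \emptyset$ for all $j<k$, and $H_{i_k} \cap H_{i_1} \ne \emptyset$. A tight-Hamiltonian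 path (resp. cycle) is a labeling such that all of $H_1, \dots, H_{n-d}$ (resp. $H_1,\dots,H_n$) are facets of $\Delta$. Tight- and loose-Hamiltonian paths/cycles (the latter in the sense of Kühn–Osthus / Benedetti–Seccia–Varbaro) are special cases of weakly-Hamiltonian ones, so the absence of weakly-Hamiltonian paths/cycles implies the absence of the other kinds. -}

module Defs where

open import Data.Nat using (ℕ; zero; suc; _+_; _*_; _∸_; _<_; _≤_; NonZero)
open import Data.Nat.DivMod using (_%_; m%n<n)
open import Data.Fin using (Fin; zero; suc; fromℕ<; fromℕ; inject₁)
open import Data.Fin.Subset using (Subset; ⋃; ⁅_⁆; inside; _∈_; ∣_∣)
open import Data.Vec using (_∷_)
open import Data.List using (List; map; upTo)
open import Data.Product using (Σ; ∃; _×_)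
open import Function.Bundles using (_↔_; Inverse)
open import Relation.Binary.PropositionalEquality using (_≡_)

-- Vertices of a complex on n vertices: Fin n.  A pure complex is given by
-- its set of facets, a predicate on vertex subsets.
Complex : ℕ → Set₁
Complex n = Subset n → Set

-- A labeling: bijection from labels (Fin n, i.e. labels 0,…,n-1 standing
-- for 1,…,n) to vertices.
Labeling : ℕ → Set
Labeling n = Fin n ↔ Fin n

lab : (n : ℕ) → .{{_ : NonZero n}} → ℕ → Fin n
lab n i = fromℕ< (m%n<n i n)

H : (n d : ℕ) → .{{_ : NonZero n}} → Labeling n → ℕ → Subset n
H n d σ i = ⋃ (map (λ k → ⁅ Inverse.to σ (lab n (i + k)) ⁆) (upTo (suc d)))

-- Weakly-Hamiltonian path (0-based labels: 0 = i₁ < … < i_k = n-d-1,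
-- consecutive gaps ≤ d, every H_{i_j} a facet).
record WeakHamPath (n d : ℕ) .{{_ : NonZero n}} (Δ : Complex n) : Set where
  field
    σ     : Labeling n
    m     : ℕ
    ι     : Fin (suc m) → ℕ
    first : ι zero ≡ 0
    final : ι (fromℕ m) ≡ n ∸ d ∸ 1
    incr  : (j : Fin m) → ι (inject₁ j) < ι (suc j)
    gap   : (j : Fin m) → ι (suc j) ≤ ι (inject₁ j) + d
    facet : (j : Fin (suc m)) → Δ (H n d σ (ι j))

-- Weakly-Hamiltonian cycle (0-based: 0 ≤ i₁ < … < i_k ≤ n-1).
record WeakHamCycle (n d : ℕ) .{{_ : NonZero n}} (Δ : Complex n) : Set where
  field
    σ      : Labeling n
    m      : ℕ
    ι      : Fin (suc m) → ℕ
    bound  : (j : Fin (suc m)) → ι j < n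
    incr   : (j : Fin m) → ι (inject₁ j) < ι (suc j)
    facet  : (j : Fin (suc m)) → Δ (H n d σ (ι j))
    cover  : (x : Fin n) → ∃ λ j → x ∈ H n d σ (ι j)
    meet   : (j : Fin m) → ∃ λ x → x ∈ H n d σ (ι (inject₁ j)) × x ∈ H n d σ (ι (suc j))
    close  : ∃ λ x → x ∈ H n d σ (ι (fromℕ m)) × x ∈ H n d σ (ι zero)

-- The complex D_d on n = 2d+2 vertices: vertex zero is the apex v, the
-- remaining 2d+1 vertices form V.  Facets: {v} ∪ A, A ⊆ V, |A| = d.
N : ℕ → ℕ
N d = suc (suc (2 * d))

D : (d : ℕ) → Complex (N d)
D d S = Σ (Subset (suc (2 * d))) λ A → ∣ A ∣ ≡ d × S ≡ inside ∷ A

{-# OPTIONS --safe #-}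
-- Every facet of D_d contains the apex v, while a window H_i consists of d+1
-- consecutive labels out of n = 2(d+1), so it never contains two labels at
-- distance d+1 ("antipodes").  A weakly-Hamiltonian path must use the windows
-- H_1 and H_{d+2}, which are antipodal translates of each other, so they cannot
-- both contain v.  A weakly-Hamiltonian cycle must cover the vertex antipodal
-- to v by some window, which then contains both v and its antipode.  For the
-- degree bound, a vertex y of V lies in the d+2 distinct facets {v, y} ∪ B,
-- where B runs over the blocks of d-1 consecutive vertices of V ∖ {y} starting
-- at one of its first d+2 vertices.
module Submission where

open import Defs
open import Data.Nat using (ℕ; zero; suc; _+_; _*_; _∸_; _≤_; _<_; z≤n; s≤s; s≤s⁻¹; NonZero; _%_; _/_)
open import Data.Nat.Properties
open import Data.Nat.DivMod using (m≡m%n+[m/n]*n; %-distribˡ-+; m%n%n≡m%n; m%n<n)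
open import Data.Nat.Tactic.RingSolver using (solve-∀)
open import Data.Fin as Fin using (Fin; toℕ; fromℕ)
open import Data.Fin.Properties using (toℕ-fromℕ<)
open import Data.Fin.Subset using (Subset; _∈_; inside; outside; ⋃; ∣_∣)
open import Data.Fin.Subset.Properties using (x∈p∪q⁻; ∉⊥; x∈⁅y⁆⇒x≡y)
open import Data.Vec using ([]; _∷_; insertAt; removeAt; here; there)
open import Data.Vec.Properties using (∷-injectiveʳ; insertAt-lookup; lookup⇒[]=; removeAt-insertAt)
open import Data.List using (List; length; applyUpTo)
open import Data.List.Properties using (length-applyUpTo; map-upTo)
open import Data.List.Relation.Unary.All using (All)
import Data.List.Relation.Unary.All as All
import Data.List.Relation.Unary.All.Properties as All
open import Data.List.Relation.Unary.Unique.Propositional using (Unique)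
import Data.List.Relation.Unary.Unique.Propositional.Properties as Unique
open import Data.Product using (∃; _×_; _,_)
open import Data.Sum using (inj₁; inj₂)
open import Data.Empty using (⊥; ⊥-elim)
open import Function.Base using (_∘_)
open import Function.Bundles using (Inverse)
open import Relation.Nullary using (¬_)
open import Relation.Binary.PropositionalEquality

m<n<m+o⇒m%o≢n%o : ∀ {m n} o .{{_ : NonZero o}} → m < n → n < m + o → m % o ≢ n % o
m<n<m+o⇒m%o≢n%o {m} {n} o m<n n<m+o m%o≡n%o = <⇒≱ m/o<n/o (s≤s⁻¹ n/o<1+m/o)
  where
  r = m % o
  m≡ : m ≡ r + m / o * o
  m≡ = m≡m%n+[m/n]*n m o
  n≡ : n ≡ r + n / o * o
  n≡ = trans (m≡m%n+[m/n]*n n o) (cong (_+ n / o * o) (sym m%o≡n%o))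
  m+o≡ : m + o ≡ r + suc (m / o) * o
  m+o≡ = trans (cong (_+ o) m≡) (trans (+-assoc r _ o) (cong (r +_) (+-comm _ o)))
  m/o<n/o : m / o < n / o
  m/o<n/o = *-cancelʳ-< o _ _ (+-cancelˡ-< r _ _ (subst₂ _<_ m≡ n≡ m<n))
  n/o<1+m/o : n / o < suc (m / o)
  n/o<1+m/o = *-cancelʳ-< o _ _ (+-cancelˡ-< r _ _ (subst₂ _<_ n≡ m+o≡ n<m+o))

[m%n+o]%n≡[m+o]%n : ∀ m o n .{{_ : NonZero n}} → (m % n + o) % n ≡ (m + o) % n
[m%n+o]%n≡[m+o]%n m o n = begin
  (m % n + o) % n          ≡⟨ %-distribˡ-+ (m % n) o n ⟩
  (m % n % n + o % n) % n  ≡⟨ cong (λ v → (v + o % n) % n) (m%n%n≡m%n m n) ⟩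
  (m % n + o % n) % n      ≡⟨ %-distribˡ-+ m o n ⟨
  (m + o) % n              ∎
  where open ≡-Reasoning

N≡[1+d]+[1+d] : ∀ d → N d ≡ suc d + suc d
N≡[1+d]+[1+d] d = cong suc (trans (cong (λ v → suc (d + v)) (+-identityʳ d)) (sym (+-suc d d)))

N∸d∸1≡1+d : ∀ d → N d ∸ d ∸ 1 ≡ suc d
N∸d∸1≡1+d d = begin
  N d ∸ d ∸ 1              ≡⟨ ∸-+-assoc (N d) d 1 ⟩
  N d ∸ (d + 1)            ≡⟨ cong₂ _∸_ (N≡[1+d]+[1+d] d) (+-comm d 1) ⟩
  suc d + suc d ∸ suc d    ≡⟨ m+n∸n≡m (suc d) (suc d) ⟩
  suc d                    ∎
  where open ≡-Reasoning

window-has-no-antipodes : ∀ d i {k k'} → k < suc d → k' < suc d →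
                          (i + k) % N d ≢ (i + k' + suc d) % N d
window-has-no-antipodes d i {k} {k'} k≤d k'≤d = m<n<m+o⇒m%o≢n%o (N d) left right
  where
  left : i + k < i + k' + suc d
  left = subst (i + k <_) (sym (+-assoc i k' (suc d)))
           (+-monoʳ-< i (<-≤-trans k≤d (m≤n+m (suc d) k')))
  k'+1+d<N : k' + suc d < N d
  k'+1+d<N = subst (k' + suc d <_) (sym (N≡[1+d]+[1+d] d)) (+-monoˡ-< (suc d) k'≤d)
  right : i + k' + suc d < i + k + N d
  right = subst₂ _<_ (sym (+-assoc i k' (suc d))) (sym (+-assoc i k (N d)))
            (+-monoʳ-< i (<-≤-trans k'+1+d<N (m≤n+m (N d) k)))

∈⋃-applyUpTo⁻ : ∀ {n} {x : Fin n} (f : ℕ → Subset n) m →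
                x ∈ ⋃ (applyUpTo f m) → ∃ λ k → k < m × x ∈ f k
∈⋃-applyUpTo⁻ f zero x∈ = ⊥-elim (∉⊥ x∈)
∈⋃-applyUpTo⁻ f (suc m) x∈ with x∈p∪q⁻ (f 0) _ x∈
... | inj₁ x∈f0 = 0 , s≤s z≤n , x∈f0
... | inj₂ x∈rest with ∈⋃-applyUpTo⁻ (λ k → f (suc k)) m x∈rest
...   | k , k<m , x∈fk = suc k , s≤s k<m , x∈fk

position : ∀ {n} → Labeling n → Fin n → ℕ
position σ x = toℕ (Inverse.from σ x)

∈H⇒position : ∀ {n} d .{{_ : NonZero n}} (σ : Labeling n) i {x} → x ∈ H n d σ i →
              ∃ λ k → k < suc d × position σ x ≡ (i + k) % n
∈H⇒position {n} d σ i {x} x∈H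
  with ∈⋃-applyUpTo⁻ _ (suc d) (subst (x ∈_) (cong ⋃ (map-upTo _ (suc d))) x∈H)
... | k , k≤d , x∈⁅σ[i+k]⁆ = k , k≤d , (begin
  toℕ (from x)                      ≡⟨ cong (toℕ ∘ from) (x∈⁅y⁆⇒x≡y _ x∈⁅σ[i+k]⁆) ⟩
  toℕ (from (to (lab n (i + k))))   ≡⟨ cong toℕ (strictlyInverseʳ _) ⟩
  toℕ (lab n (i + k))               ≡⟨ toℕ-fromℕ< (m%n<n (i + k) n) ⟩
  (i + k) % n                       ∎)
  where
  open Inverse σ
  open ≡-Reasoning

apex∈facet : ∀ {d S} → D d S → Fin.zero ∈ S
apex∈facet (_ , _ , refl) = here

no-weak-path : ∀ d → ¬ WeakHamPath (N d) d (D d)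
no-weak-path d P = apex-in-disjoint-windows
  where
  open WeakHamPath P
  first-window : D d (H (N d) d σ 0)
  first-window = subst (λ i → D d (H (N d) d σ i)) first (facet Fin.zero)
  last-window : D d (H (N d) d σ (suc d))
  last-window = subst (λ i → D d (H (N d) d σ i)) (trans final (N∸d∸1≡1+d d)) (facet (fromℕ m))
  apex-in-disjoint-windows : ⊥
  apex-in-disjoint-windows
    with ∈H⇒position d σ 0 (apex∈facet first-window)
       | ∈H⇒position d σ (suc d) (apex∈facet last-window)
  ... | k , k≤d , p≡k | k' , k'≤d , p≡1+d+k' =
    window-has-no-antipodes d 0 k≤d k'≤d
      (trans (sym p≡k) (trans p≡1+d+k' (cong (_% N d) (+-comm (suc d) k'))))

no-weak-cycle : ∀ d → ¬ WeakHamCycle (N d) d (D d)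
no-weak-cycle d C = antipode-of-apex-uncovered
  where
  open WeakHamCycle C
  open Inverse σ using (to; strictlyInverseʳ)
  n = N d
  p = position σ Fin.zero
  antipode : Fin n
  antipode = to (lab n (p + suc d))
  position-antipode : position σ antipode ≡ (p + suc d) % n
  position-antipode = trans (cong toℕ (strictlyInverseʳ _)) (toℕ-fromℕ< (m%n<n (p + suc d) n))
  antipode-of-apex-uncovered : ⊥
  antipode-of-apex-uncovered with cover antipode
  ... | j , antipode∈H
    with ∈H⇒position d σ (ι j) antipode∈H | ∈H⇒position d σ (ι j) (apex∈facet (facet j))
  ... | k , k≤d , pa≡ | k' , k'≤d , p≡ = window-has-no-antipodes d (ι j) k≤d k'≤d (begin
    (ι j + k) % n                ≡⟨ sym pa≡ ⟩
    position σ antipode          ≡⟨ position-antipode ⟩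
    (p + suc d) % n              ≡⟨ cong (λ v → (v + suc d) % n) p≡ ⟩
    ((ι j + k') % n + suc d) % n ≡⟨ [m%n+o]%n≡[m+o]%n (ι j + k') (suc d) n ⟩
    (ι j + k' + suc d) % n       ∎)
    where open ≡-Reasoning

block : (n a e : ℕ) → Subset n
block zero    a       e       = []
block (suc n) (suc a) e       = outside ∷ block n a e
block (suc n) zero    (suc e) = inside ∷ block n zero e
block (suc n) zero    zero    = outside ∷ block n zero zero

∣block∣ : ∀ n a e → a + e ≤ n → ∣ block n a e ∣ ≡ e
∣block∣ zero    zero    zero    _           = refl
∣block∣ (suc n) (suc a) e       (s≤s a+e≤n) = ∣block∣ n a e a+e≤n
∣block∣ (suc n) zero    (suc e) (s≤s e≤n)   = cong suc (∣block∣ n zero e e≤n)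
∣block∣ (suc n) zero    zero    _           = ∣block∣ n zero zero z≤n

block-injective : ∀ n {a b} e → a < b → b + suc e ≤ n → block n a (suc e) ≢ block n b (suc e)
block-injective (suc n) {zero}  {suc b} e _         _           ()
block-injective (suc n) {suc a} {suc b} e (s≤s a<b) (s≤s b+e<n) eq =
  block-injective n e a<b b+e<n (∷-injectiveʳ eq)

∣insertAt-inside∣ : ∀ {n} (p : Subset n) i → ∣ insertAt p i inside ∣ ≡ suc ∣ p ∣
∣insertAt-inside∣ p             Fin.zero    = refl
∣insertAt-inside∣ (inside ∷ p)  (Fin.suc i) = cong suc (∣insertAt-inside∣ p i)
∣insertAt-inside∣ (outside ∷ p) (Fin.suc i) = ∣insertAt-inside∣ p i

i∈insertAt-inside : ∀ {n} (p : Subset n) i → i ∈ insertAt p i inside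
i∈insertAt-inside p i = lookup⇒[]= i _ (insertAt-lookup p i inside)

insertAt-injective : ∀ {n} {p q : Subset n} i → insertAt p i inside ≡ insertAt q i inside → p ≡ q
insertAt-injective {p = p} {q} i eq = begin
  p                                ≡⟨ removeAt-insertAt p i inside ⟨
  removeAt (insertAt p i inside) i ≡⟨ cong (λ r → removeAt r i) eq ⟩
  removeAt (insertAt q i inside) i ≡⟨ removeAt-insertAt q i inside ⟩
  q                                ∎
  where open ≡-Reasoning

facets-through-apex-and : ∀ {d} → 2 ≤ d → (y : Fin (suc (2 * d))) →
  ∃ λ (L : List (Subset (N d))) →
    Unique L × All (λ S → D d S × Fin.zero ∈ S × Fin.suc y ∈ S) L × length L ≡ 2 + d
facets-through-apex-and {suc (suc f)} (s≤s (s≤s z≤n)) y =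
  applyUpTo facet-at (2 + d) ,
  Unique.applyUpTo⁺₁ facet-at (2 + d)
    (λ a<b b<2+d eq → block-injective (2 * d) f a<b (block-fits b<2+d)
                        (insertAt-injective y (∷-injectiveʳ eq))) ,
  All.applyUpTo⁺₁ facet-at (2 + d)
    (λ {a} a<2+d → (_ , facet-size a<2+d , refl) , here , there (i∈insertAt-inside _ y)) ,
  length-applyUpTo facet-at (2 + d)
  where
  d = suc (suc f)
  facet-at : ℕ → Subset (N d)
  facet-at a = inside ∷ insertAt (block (2 * d) a (suc f)) y inside
  [3+f]+[1+f]≡2*[2+f] : ∀ f → suc (suc (suc f)) + suc f ≡ 2 * suc (suc f)
  [3+f]+[1+f]≡2*[2+f] = solve-∀
  block-fits : ∀ {a} → a < 2 + d → a + suc f ≤ 2 * d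
  block-fits (s≤s a≤1+d) = ≤-trans (+-monoˡ-≤ (suc f) a≤1+d) (≤-reflexive ([3+f]+[1+f]≡2*[2+f] f))
  facet-size : ∀ {a} → a < 2 + d → ∣ insertAt (block (2 * d) a (suc f)) y inside ∣ ≡ d
  facet-size a<2+d = trans (∣insertAt-inside∣ _ y) (cong suc (∣block∣ (2 * d) _ (suc f) (block-fits a<2+d)))

vertex-of-V : ∀ {m} → Fin (suc (suc m)) → Fin (suc m)
vertex-of-V Fin.zero    = Fin.zero
vertex-of-V (Fin.suc y) = y

N<2*[2+d] : ∀ d → N d < 2 * (2 + d)
N<2*[2+d] d = ≤-trans (n≤1+n _) (≤-reflexive (3+N≡2*[2+d] d))
  where
  3+N≡2*[2+d] : ∀ d → suc (suc (suc (suc (2 * d)))) ≡ 2 * (2 + d)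
  3+N≡2*[2+d] = solve-∀

vertex-degree : ∀ {d} → 2 ≤ d → (x : Fin (N d)) →
  ∃ λ (L : List (Subset (N d))) → Unique L × All (λ S → D d S × x ∈ S) L × N d < 2 * length L
vertex-degree {d} 2≤d x with facets-through-apex-and 2≤d (vertex-of-V x)
... | L , unique , through , length≡ =
  L , unique , All.map (through-x x) through , subst (λ l → N d < 2 * l) (sym length≡) (N<2*[2+d] d)
  where
  through-x : ∀ x {S} → D d S × Fin.zero ∈ S × Fin.suc (vertex-of-V x) ∈ S → D d S × x ∈ S
  through-x Fin.zero    (S∈D , v∈S , _) = S∈D , v∈S
  through-x (Fin.suc y) (S∈D , _ , y∈S) = S∈D , y∈S

mainTheorem1 : (d : ℕ) → 2 ≤ d →
    ((x : Fin (N d)) → ∃ λ (L : List (Subset (N d))) →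
        Unique L × All (λ S → D d S × x ∈ S) L × N d < 2 * length L)
    × ¬ WeakHamPath (N d) d (D d)
    × ¬ WeakHamCycle (N d) d (D d)
mainTheorem1 d 2≤d = vertex-degree 2≤d , no-weak-path d , no-weak-cycle d
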